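{- (Progress.) Let $t$ be a term and $\rho$ a type such that $\emptyset;\emptyset\vdash t:\rho$ (empty variable context and empty continuation context). Then either $t$ is a value, or there exists a term $t'$ with $t\to t'$.
   Context: Calculus $\lambda^{::}_{\mathtt{catch}}$. Types: $\sigma,\tau,\rho ::= \mathtt{unit} \mid \mathtt{list}\,\tau \mid \sigma\to\tau$. A type is arrow-free if it contains no $\to$; $\psi$ ranges over arrow-free types. Terms: $t,r,s ::= x \mid () \mid \mathtt{nil} \mid (::) \mid \mathtt{lrec} \mid \lambda x.r \mid t\,s \mid \mathtt{catch}\,\alpha\,t \mid \mathtt{throw}\,\alpha\,t$ ($x$ variables, $\alpha,\beta$ continuation variables; $\lambda x$ binds $x$, $\mathtt{catch}\,\alpha$ binds $\alpha$; application left-associative; $t::r$ abbreviates $(::)\,t\,r$). $\mathrm{FCV}$ = free continuation variables, $t[x:=r]$ capture-avoiding substitution. Values: $v,w ::= x \mid () \mid \mathtt{nil} \mid (::) \mid (::)\,v \mid (::)\,v\,w \mid \mathtt{lrec} \mid \mathtt{lrec}\,v \mid \mathtt{lrec}\,v\,w \mid \lambda x.r$. Contexts $E ::= \Box\,t \mid v\,\Box \mid \mathtt{throw}\,\alpha\,\Box$. Reduction $\to$ is the compatible closure of: $(\lambda x.t)\,v \to t[x:=v]$; $E[\mathtt{throw}\,\alpha\,t]\to\mathtt{throw}\,\alpha\,t$; $\mathtt{catch}\,\alpha\,(\mathtt{throw}\,\alpha\,t)\to\mathtt{catch}\,\alpha\,t$; $\mathtt{catch}\,\alpha\,(\mathtt{throw}\,\beta\,v)\to\mathtt{throw}\,\beta\,v$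 if $\alpha\notin\{\beta\}\cup\mathrm{FCV}(v)$; $\mathtt{catch}\,\alpha\,v\to v$ if $\alpha\notin\mathrm{FCV}(v)$; $\mathtt{lrec}\,v_r\,v_s\,\mathtt{nil}\to v_r$; $\mathtt{lrec}\,v_r\,v_s\,(v_h::v_t)\to v_s\,v_h\,v_t\,(\mathtt{lrec}\,v_r\,v_s\,v_t)$. Typing $\Gamma;\Delta\vdash t:\rho$ ($\Delta$ maps continuation variables to arrow-free types): $x:\rho$ if $x:\rho\in\Gamma$; $():\mathtt{unit}$; $\mathtt{nil}:\mathtt{list}\,\sigma$; $(::):\sigma\to\mathtt{list}\,\sigma\to\mathtt{list}\,\sigma$; $\mathtt{lrec}:\rho\to(\sigma\to\mathtt{list}\,\sigma\to\rho\to\rho)\to\mathtt{list}\,\sigma\to\rho$; $\lambda$-introduction and application as usual for simple types; if $\Gamma;\Delta,\alpha:\psi\vdash t:\psi$ then $\Gamma;\Delta\vdash\mathtt{catch}\,\alpha\,t:\psi$ ($\psi$ arrow-free); if $\Gamma;\Delta\vdash t:\psi$ and $\alpha:\psi\in\Delta$ then $\Gamma;\Delta\vdash\mathtt{throw}\,\alpha\,t:\tau$ for any $\tau$. -}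

module Defs where

-- The calculus λ^{::}_catch, with both kinds of variables in de Bruijn
-- representation (terms are identified up to α-equivalence).
--   var x        : term variable with de Bruijn index x (bound by lam)
--   catch t      : binds continuation variable with index 0 in t
--   throw α t    : continuation variable with de Bruijn index α

open import Data.Nat using (ℕ; zero; suc)
open import Data.List using (List; []; _∷_)

infixr 7 _⇒_

data Ty : Set where
  unit : Ty
  list : Ty → Ty
  _⇒_  : Ty → Ty → Ty

data ArrowFree : Ty → Set where
  af-unit : ArrowFree unit
  af-list : ∀ {τ} → ArrowFree τ → ArrowFree (list τ)

data Term : Set where
  var   : ℕ → Term
  ⟨⟩    : Term
  nil   : Term
  cons  : Term
  lrec  : Term
  lam   : Term → Term
  app   : Term → Term → Term
  catch : Term → Term
  throw : ℕ → Term → Term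

shiftVarV : ℕ → ℕ → ℕ
shiftVarV zero    x       = suc x
shiftVarV (suc c) zero    = zero
shiftVarV (suc c) (suc x) = suc (shiftVarV c x)

shiftV : ℕ → Term → Term
shiftV c (var x)     = var (shiftVarV c x)
shiftV c ⟨⟩          = ⟨⟩
shiftV c nil         = nil
shiftV c cons        = cons
shiftV c lrec        = lrec
shiftV c (lam t)     = lam (shiftV (suc c) t)
shiftV c (app t s)   = app (shiftV c t) (shiftV c s)
shiftV c (catch t)   = catch (shiftV c t)
shiftV c (throw α t) = throw α (shiftV c t)

shiftK : ℕ → Term → Term
shiftK c (var x)     = var x
shiftK c ⟨⟩          = ⟨⟩
shiftK c nil         = nil
shiftK c cons        = cons
shiftK c lrec        = lrec
shiftK c (lam t)     = lam (shiftK c t)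
shiftK c (app t s)   = app (shiftK c t) (shiftK c s)
shiftK c (catch t)   = catch (shiftK (suc c) t)
shiftK c (throw α t) = throw (shiftVarV c α) (shiftK c t)

-- substitution for variable j (variables above j are lowered by one)
substVar : ℕ → Term → ℕ → Term
substVar zero    s zero    = s
substVar zero    s (suc x) = var x
substVar (suc j) s zero    = var zero
substVar (suc j) s (suc x) = shiftV 0 (substVar j s x)

subst : ℕ → Term → Term → Term
subst j s (var x)     = substVar j s x
subst j s ⟨⟩          = ⟨⟩
subst j s nil         = nil
subst j s cons        = cons
subst j s lrec        = lrec
subst j s (lam t)     = lam (subst (suc j) (shiftV 0 s) t)
subst j s (app t r)   = app (subst j s t) (subst j s r)
subst j s (catch t)   = catch (subst j (shiftK 0 s) t)
subst j s (throw α t) = throw α (subst j s t)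

_[0:=_] : Term → Term → Term
t [0:= v ] = subst 0 v t

data Value : Term → Set where
  v-var   : ∀ x → Value (var x)
  v-unit  : Value ⟨⟩
  v-nil   : Value nil
  v-cons0 : Value cons
  v-cons1 : ∀ {v} → Value v → Value (app cons v)
  v-cons2 : ∀ {v w} → Value v → Value w → Value (app (app cons v) w)
  v-lrec0 : Value lrec
  v-lrec1 : ∀ {v} → Value v → Value (app lrec v)
  v-lrec2 : ∀ {v w} → Value v → Value w → Value (app (app lrec v) w)
  v-lam   : ∀ r → Value (lam r)

infix 4 _⟶_

-- Side conditions "α ∉ FCV(v)" are expressed by requiring the term to be
-- of the form shiftK 0 v (i.e. it does not mention the bound index 0).
data _⟶_ : Term → Term → Set where
  β-v        : ∀ {t v} → Value v → app (lam t) v ⟶ t [0:= v ]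
  throw-appL : ∀ {α t s} → app (throw α t) s ⟶ throw α t
  throw-appR : ∀ {v α t} → Value v → app v (throw α t) ⟶ throw α t
  throw-throw : ∀ {β α t} → throw β (throw α t) ⟶ throw α t
  catch-throw-same : ∀ {t} → catch (throw zero t) ⟶ catch t
  catch-throw-other : ∀ {β v} → Value v →
    catch (throw (suc β) (shiftK 0 v)) ⟶ throw β v
  catch-val  : ∀ {v} → Value v → catch (shiftK 0 v) ⟶ v
  lrec-nil   : ∀ {vr vs} → Value vr → Value vs →
    app (app (app lrec vr) vs) nil ⟶ vr
  lrec-cons  : ∀ {vr vs vh vt} → Value vr → Value vs → Value vh → Value vt →
    app (app (app lrec vr) vs) (app (app cons vh) vt)
      ⟶ app (app (app vs vh) vt) (app (app (app lrec vr) vs) vt)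
  ξ-lam   : ∀ {t t'} → t ⟶ t' → lam t ⟶ lam t'
  ξ-appL  : ∀ {t t' s} → t ⟶ t' → app t s ⟶ app t' s
  ξ-appR  : ∀ {t s s'} → s ⟶ s' → app t s ⟶ app t s'
  ξ-catch : ∀ {t t'} → t ⟶ t' → catch t ⟶ catch t'
  ξ-throw : ∀ {α t t'} → t ⟶ t' → throw α t ⟶ throw α t'

infix 4 _∋_∶_
data _∋_∶_ : List Ty → ℕ → Ty → Set where
  here  : ∀ {Γ ρ} → (ρ ∷ Γ) ∋ zero ∶ ρ
  there : ∀ {Γ x ρ σ} → Γ ∋ x ∶ ρ → (σ ∷ Γ) ∋ suc x ∶ ρ

infix 4 _⨾_⊢_∶_
data _⨾_⊢_∶_ (Γ Δ : List Ty) : Term → Ty → Set where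
  ⊢var   : ∀ {x ρ} → Γ ∋ x ∶ ρ → Γ ⨾ Δ ⊢ var x ∶ ρ
  ⊢unit  : Γ ⨾ Δ ⊢ ⟨⟩ ∶ unit
  ⊢nil   : ∀ {σ} → Γ ⨾ Δ ⊢ nil ∶ list σ
  ⊢cons  : ∀ {σ} → Γ ⨾ Δ ⊢ cons ∶ σ ⇒ list σ ⇒ list σ
  ⊢lrec  : ∀ {ρ σ} → Γ ⨾ Δ ⊢ lrec ∶ ρ ⇒ (σ ⇒ list σ ⇒ ρ ⇒ ρ) ⇒ list σ ⇒ ρ
  ⊢lam   : ∀ {σ τ r} → (σ ∷ Γ) ⨾ Δ ⊢ r ∶ τ → Γ ⨾ Δ ⊢ lam r ∶ σ ⇒ τ
  ⊢app   : ∀ {σ τ t s} → Γ ⨾ Δ ⊢ t ∶ σ ⇒ τ → Γ ⨾ Δ ⊢ s ∶ σ → Γ ⨾ Δ ⊢ app t s ∶ τ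
  ⊢catch : ∀ {ψ t} → ArrowFree ψ → Γ ⨾ (ψ ∷ Δ) ⊢ t ∶ ψ → Γ ⨾ Δ ⊢ catch t ∶ ψ
  ⊢throw : ∀ {ψ α t τ} → Δ ∋ α ∶ ψ → Γ ⨾ Δ ⊢ t ∶ ψ → Γ ⨾ Δ ⊢ throw α t ∶ τ

-- Progress is proved for closed terms in an arbitrary continuation context Δ
-- of arrow-free types, where a third outcome is allowed: the term is
-- throw α v for a value v.  Such a throw is absorbed by any evaluation
-- context and by catch, the latter because a closed value of arrow-free type
-- is built from (), nil and (::) only and hence mentions no continuation
-- variable.  With Δ empty the third outcome is impossible.
module Submission where

open import Defs
open import Data.List using (List; []; _∷_)
open import Data.List.Relation.Unary.All using (All; []; _∷_)
open import Data.Nat using (suc)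
open import Data.Product using (∃; _,_)
open import Data.Sum using (_⊎_; inj₁; inj₂)
open import Relation.Binary.PropositionalEquality as Eq using (_≡_; refl; cong₂)

lookup-ArrowFree : ∀ {Δ α ψ} → All ArrowFree Δ → Δ ∋ α ∶ ψ → ArrowFree ψ
lookup-ArrowFree (a ∷ _)  here      = a
lookup-ArrowFree (_ ∷ as) (there p) = lookup-ArrowFree as p

shiftK-closed-arrowFree-value : ∀ {Δ v ψ} c → [] ⨾ Δ ⊢ v ∶ ψ → Value v → ArrowFree ψ →
                                shiftK c v ≡ v
shiftK-closed-arrowFree-value c (⊢var ()) (v-var _) _
shiftK-closed-arrowFree-value c (⊢app ⊢cons _) (v-cons1 _) ()
shiftK-closed-arrowFree-value c (⊢app ⊢lrec _) (v-lrec1 _) ()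
shiftK-closed-arrowFree-value c (⊢app (⊢app ⊢lrec _) _) (v-lrec2 _ _) ()
shiftK-closed-arrowFree-value c _ v-unit _ = refl
shiftK-closed-arrowFree-value c _ v-nil  _ = refl
shiftK-closed-arrowFree-value c (⊢app (⊢app ⊢cons dh) dt) (v-cons2 vh vt) (af-list a) =
  cong₂ (λ h t → app (app cons h) t)
        (shiftK-closed-arrowFree-value c dh vh a)
        (shiftK-closed-arrowFree-value c dt vt (af-list a))

-- The side condition "α ∉ FCV(v)" of the catch rules, met by a value that shiftK leaves fixed.
catch-val′ : ∀ {v} → Value v → shiftK 0 v ≡ v → catch v ⟶ v
catch-val′ {v} vv eq = Eq.subst (λ u → catch u ⟶ v) eq (catch-val vv)

catch-throw-other′ : ∀ {β v} → Value v → shiftK 0 v ≡ v → catch (throw (suc β) v) ⟶ throw β v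
catch-throw-other′ {β} {v} vv eq =
  Eq.subst (λ u → catch (throw (suc β) u) ⟶ throw β v) eq (catch-throw-other vv)

data ListValue : Term → Set where
  nil  : ListValue nil
  cons : ∀ {vh vt} → Value vh → Value vt → ListValue (app (app cons vh) vt)

canonical-list : ∀ {Δ v σ} → [] ⨾ Δ ⊢ v ∶ list σ → Value v → ListValue v
canonical-list (⊢var ()) (v-var _)
canonical-list (⊢app (⊢app () _) _) (v-lrec2 _ _)
canonical-list _ v-nil           = nil
canonical-list _ (v-cons2 vh vt) = cons vh vt

progress-app-values : ∀ {Δ t s σ τ} → [] ⨾ Δ ⊢ t ∶ σ ⇒ τ → [] ⨾ Δ ⊢ s ∶ σ →
                      Value t → Value s → Value (app t s) ⊎ ∃ λ u → app t s ⟶ u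
progress-app-values (⊢var ()) _ (v-var _) _
progress-app-values (⊢app (⊢app () _) _) _ (v-cons2 _ _) _
progress-app-values _ _ v-cons0     vs = inj₁ (v-cons1 vs)
progress-app-values _ _ (v-cons1 v) vs = inj₁ (v-cons2 v vs)
progress-app-values _ _ v-lrec0     vs = inj₁ (v-lrec1 vs)
progress-app-values _ _ (v-lrec1 v) vs = inj₁ (v-lrec2 v vs)
progress-app-values _ _ (v-lam _)   vs = inj₂ (_ , β-v vs)
progress-app-values (⊢app (⊢app ⊢lrec _) _) ds (v-lrec2 vr vs) vl with canonical-list ds vl
... | nil        = inj₂ (_ , lrec-nil vr vs)
... | cons vh vt = inj₂ (_ , lrec-cons vr vs vh vt)

data Progress (Δ : List Ty) : Term → Set where
  done     : ∀ {t} → Value t → Progress Δ t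
  step     : ∀ {t u} → t ⟶ u → Progress Δ t
  throwing : ∀ {α v ψ} → Δ ∋ α ∶ ψ → ArrowFree ψ → Value v → [] ⨾ Δ ⊢ v ∶ ψ →
             Progress Δ (throw α v)

progress : ∀ {Δ t ρ} → All ArrowFree Δ → [] ⨾ Δ ⊢ t ∶ ρ → Progress Δ t
progress A (⊢var ())
progress A ⊢unit    = done v-unit
progress A ⊢nil     = done v-nil
progress A ⊢cons    = done v-cons0
progress A ⊢lrec    = done v-lrec0
progress A (⊢lam _) = done (v-lam _)
progress A (⊢app dt ds) with progress A dt
... | step st             = step (ξ-appL st)
... | throwing _ _ _ _    = step throw-appL
... | done vt with progress A ds
...   | step ss           = step (ξ-appR ss)
...   | throwing _ _ _ _  = step (throw-appR vt)
...   | done vs with progress-app-values dt ds vt vs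
...     | inj₁ v          = done v
...     | inj₂ (_ , st)   = step st
progress A (⊢throw p d) with progress A d
... | done v              = throwing p (lookup-ArrowFree A p) v d
... | step st             = step (ξ-throw st)
... | throwing _ _ _ _    = step throw-throw
progress A (⊢catch a d) with progress (a ∷ A) d
... | done v              = step (catch-val′ v (shiftK-closed-arrowFree-value 0 d v a))
... | step st             = step (ξ-catch st)
... | throwing here _ _ _ = step catch-throw-same
... | throwing (there _) a′ v d′ =
  step (catch-throw-other′ v (shiftK-closed-arrowFree-value 0 d′ v a′))

theorem2p15 : ∀ {t ρ} → [] ⨾ [] ⊢ t ∶ ρ → Value t ⊎ ∃ λ t' → t ⟶ t'
theorem2p15 d with progress [] d
... | done v            = inj₁ v
... | step st           = inj₂ (_ , st)
... | throwing () _ _ _
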